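{- Let $T$ be a condensed multi-Catalan tableau of type $X$, and let $c$ be a corner of $T$ that contains an $\alpha$. Then the result of the transition of $T$ at $c$ (corner transition, case where the corner contains $\alpha$) is a valid condensed multi-Catalan tableau, whose type is the word obtained from $X$ by swapping the two letters associated with $c$ (i.e. $X'\mathrm{DE}X''\mapsto X'\mathrm{ED}X''$, $X'\mathrm{DA}X''\mapsto X'\mathrm{AD}X''$, or $X'\mathrm{AE}X''\mapsto X'\mathrm{EA}X''$).
   Context: Condensed multi-Catalan tableaux. Let $X\in\{\mathrm D,\mathrm E,\mathrm A\}^n$ have $k$ letters $\mathrm D$ and $r$ letters $\mathrm A$. Starting at the north-east corner of a rectangle with $k+r$ rows and $n-k$ columns, draw the lattice path $L(X)$ by reading $X$ left to right: $\mathrm D$ gives a south step, $\mathrm E$ a west step, $\mathrm A$ a west step followed by a south step. Let $Y(X)$ be the Young diagram (rows left-justified and top-justified in the rectangle) whose south-east boundary is $L(X)$: its $i$-th row (from the top) has length equal to the number of west steps of $L(X)$ after its $i$-th south step. Each row corresponds to a south step (its east edge) and each column to a west step (its bottom edge). A row is a D-row or A-row according as its south step comes from a $\mathrm D$ or an $\mathrm A$; a column is an E-column or A-column according as its west step comes from an $\mathrm E$ or an $\mathrm A$. A DE box is a box in a D-row and E-column, and similarly DA, AE, AA boxes. A condensed multi-Catalan tableau of type $X$ is a filling of the boxes of $Y(X)$, each box being empty or containing $\alpha$ or $\beta$, such that: every box having a $\beta$ somewhere to its right in its row, or an $\alpha$ somewhere below it in its column, is empty; every other box contains $\alpha$ or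 $\beta$ if it is a DE box, contains $\beta$ if it is a DA box, contains $\alpha$ if it is an AE box, and is empty if it is an AA box. A corner of $T$ is a DE, DA or AE box that is both the rightmost box of its row and the bottommost box of its column; corners correspond exactly to the occurrences of consecutive letters $\mathrm{DE}$, $\mathrm{DA}$, $\mathrm{AE}$ in $X$ (a south step immediately followed by a west step). Corner transition, case where the corner lies in a column of length $\mu$ and contains $\alpha$: remove that column from $T$; form a new column of length $\mu-1$ whose bottom box contains $\alpha$ and whose other boxes are empty (if $\mu=1$ the new column has length $0$ and contains no $\alpha$); insert it among the remaining columns, directly to the east of every remaining column of length $\ge\mu-1$ (so that column lengths stay weakly decreasing from west to east; a length-$0$ column goes at the east end). All other columns keep their contents (boxes counted from the top). Finally the boundary path is labelled by the word obtained from $X$ by swapping the two letters associated to the corner. -}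

module Defs where

open import Data.Nat using (ℕ; zero; suc; _<_; _≤ᵇ_; pred)
open import Data.List using (List; []; _∷_; _++_; length; map; reverse; replicate)
open import Data.Maybe using (Maybe; just; nothing; maybe)
open import Data.Bool using (if_then_else_)
open import Data.Product using (Σ; _×_; _,_; proj₁; proj₂)
open import Data.Sum using (_⊎_)
open import Data.Empty using (⊥)
open import Relation.Nullary using (¬_)
open import Relation.Binary.PropositionalEquality using (_≡_)

data Letter : Set where
  D E A : Letter

Word : Set
Word = List Letter

southCount : Word → ℕ
southCount []      = zero
southCount (D ∷ w) = suc (southCount w)
southCount (E ∷ w) = southCount w
southCount (A ∷ w) = suc (southCount w)

westCount : Word → ℕ
westCount []      = zero
westCount (D ∷ w) = westCount w
westCount (E ∷ w) = suc (westCount w)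
westCount (A ∷ w) = suc (westCount w)

-- Row types, top to bottom: the letters giving the south steps, in order.
rowTypes : Word → List Letter
rowTypes []      = []
rowTypes (D ∷ w) = D ∷ rowTypes w
rowTypes (E ∷ w) = rowTypes w
rowTypes (A ∷ w) = A ∷ rowTypes w

-- West steps in reading order (= columns from EAST to WEST), each with
-- its letter and the length of its column (= number of south steps of
-- L(X) drawn before this west step; k is the running south count).
westSteps : ℕ → Word → List (Letter × ℕ)
westSteps k []      = []
westSteps k (D ∷ w) = westSteps (suc k) w
westSteps k (E ∷ w) = (E , k) ∷ westSteps k w
westSteps k (A ∷ w) = (A , k) ∷ westSteps (suc k) w   -- A: west step, then south step

-- Columns of Y(X) from WEST to EAST.
columns : Word → List (Letter × ℕ)
columns X = reverse (westSteps zero X)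

colTypes : Word → List Letter
colTypes X = map proj₁ (columns X)

colLengths : Word → List ℕ
colLengths X = map proj₂ (columns X)

data Cell : Set where
  ∅ α β : Cell

-- A filling of a Young diagram: list of columns from west to east,
-- each column listed from top to bottom.
Filling : Set
Filling = List (List Cell)

nth : {S : Set} → List S → ℕ → Maybe S
nth []       _       = nothing
nth (x ∷ xs) zero    = just x
nth (x ∷ xs) (suc n) = nth xs n

-- content of the box in column j (0-based from the west), row i
-- (0-based from the top); nothing if there is no such box
entry : Filling → ℕ → ℕ → Maybe Cell
entry T j i = maybe (λ col → nth col i) nothing (nth T j)

Blocked : Filling → ℕ → ℕ → Set
Blocked T i j =
  (Σ ℕ λ j' → j < j' × entry T j' i ≡ just β) ⊎
  (Σ ℕ λ i' → i < i' × entry T j i' ≡ just α)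

Required : Letter → Letter → Cell → Set
Required D E c = c ≡ α ⊎ c ≡ β
Required D A c = c ≡ β
Required A E c = c ≡ α
Required A A c = c ≡ ∅
Required _ _ c = ⊥     -- never occurs (rows are D/A, columns are E/A)

record IsCMCT (X : Word) (T : Filling) : Set where
  field
    shape   : map length T ≡ colLengths X
    blocked : ∀ i j c → entry T j i ≡ just c → Blocked T i j → c ≡ ∅
    free    : ∀ i j c → entry T j i ≡ just c → ¬ Blocked T i j →
              ∀ r k → nth (rowTypes X) i ≡ just r → nth (colTypes X) j ≡ just k →
              Required r k c

data CornerPair : Letter → Letter → Set where
  DE : CornerPair D E
  DA : CornerPair D A
  AE : CornerPair A E

-- For X = X' ++ a ∷ b ∷ X'' with CornerPair a b, the corner box lies in
-- row  southCount X'  (0-based from top; a is the south step)  and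
-- column  westCount X''  (0-based from west; b is the west step).

removeAt : {S : Set} → ℕ → List S → List S
removeAt _       []       = []
removeAt zero    (x ∷ xs) = xs
removeAt (suc n) (x ∷ xs) = x ∷ removeAt n xs

colLen : Filling → ℕ → ℕ
colLen T j = maybe length zero (nth T j)

newCol : ℕ → List Cell
newCol zero    = []
newCol (suc m) = replicate m ∅ ++ (α ∷ [])

-- insert column c directly to the east of every (leading, since lengths
-- are weakly decreasing) column of length ≥ m
insertCol : ℕ → List Cell → Filling → Filling
insertCol m c []       = c ∷ []
insertCol m c (d ∷ ds) =
  if m ≤ᵇ length d then d ∷ insertCol m c ds else c ∷ d ∷ ds

transitionα : Filling → ℕ → Filling
transitionα T j = insertCol (pred μ) (newCol (pred μ)) (removeAt j T)
  where μ = colLen T j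

-- Reading Y(X) column by column, the constraints on a box involve only its own column, its
-- row type and the set of rows holding a β further east. The corner column has α at its
-- bottom, so its other boxes are blocked, hence empty: it holds no β, and neither does the
-- new column. So removing the one and inserting the other leaves every other column valid.
-- The new column, of height p = southCount X', lands just east of all columns of height ≥ p,
-- so nothing east of it can block its bottom α, which an E-column admits in any row.
-- On the word side, the columns of X' are a run of E-columns of height p followed by shorter
-- ones; placing the new E-column of height p at the east end of that run, as the transition
-- does, or at its west end, as the swapped word does, gives the same column types and lengths.
-- In the DA case the corner box cannot hold α at all.
module Submission where

open import Defs
open import Data.Bool using (true; false)
open import Data.Empty using (⊥-elim)
open import Data.List using (List; []; _∷_; _++_; _ʳ++_; _∷ʳ_; [_]; length; map; reverse; replicate)
open import Data.List.Properties
  using (ʳ++-defn; reverse-++; ++-assoc; length-map; length-reverse; ∷-injectiveˡ; ∷-injectiveʳ)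
open import Data.List.Relation.Unary.All using (All; []; _∷_)
import Data.List.Relation.Unary.All as All
open import Data.List.Relation.Unary.All.Properties using (replicate⁺; ++⁺; map⁺; map⁻; All¬⇒¬Any)
open import Data.List.Relation.Unary.Any using (Any; here; there)
open import Data.List.Relation.Unary.Any.Properties using (++⁺ˡ; ++⁺ʳ; ++⁻)
open import Data.List.Reverse using (Reverse; []; _∶_∶ʳ_; reverseView)
open import Data.Maybe using (just; nothing; maybe)
open import Data.Nat using (ℕ; zero; suc; _+_; _≤_; _<_; z≤n; s≤s; _≤ᵇ_)
open import Data.Nat.Properties
  using ( +-suc; +-identityʳ; ≤-refl; ≤-trans; n≤1+n; m<n⇒m<1+n; <-asym; <-irrefl; <-cmp
        ; ≤ᵇ⇒≤; ≤⇒≤ᵇ; <⇒≱; suc-injective)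
open import Data.Product using (∃-syntax; ∃₂; _×_; _,_; proj₁; proj₂)
import Data.Product as Product
open import Data.Sum using (_⊎_; inj₁; inj₂; [_,_]′)
import Data.Sum as Sum
open import Function using (_∘_)
open import Function.Bundles using (_⇔_; mk⇔; Equivalence)
import Function.Properties.Equivalence as ⇔
open import Relation.Binary using (tri<; tri≈; tri>)
open import Relation.Binary.PropositionalEquality
  using (_≡_; _≢_; refl; sym; trans; cong; cong₂; subst; subst₂; module ≡-Reasoning)
open import Relation.Nullary using (¬_)

open Equivalence using (to; from)

westSteps-++ : ∀ k X Y → westSteps k (X ++ Y) ≡ westSteps k X ++ westSteps (k + southCount X) Y
westSteps-++ k []      Y = cong (λ n → westSteps n Y) (sym (+-identityʳ k))
westSteps-++ k (D ∷ X) Y rewrite +-suc k (southCount X) = westSteps-++ (suc k) X Y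
westSteps-++ k (E ∷ X) Y = cong ((E , k) ∷_) (westSteps-++ k X Y)
westSteps-++ k (A ∷ X) Y rewrite +-suc k (southCount X) = cong ((A , k) ∷_) (westSteps-++ (suc k) X Y)

columns-++ : ∀ X Y → columns (X ++ Y) ≡ westSteps (southCount X) Y ʳ++ columns X
columns-++ X Y = begin
  reverse (westSteps 0 (X ++ Y))    ≡⟨ cong reverse (westSteps-++ 0 X Y) ⟩
  reverse (westSteps 0 X ++ steps)  ≡⟨ reverse-++ (westSteps 0 X) steps ⟩
  reverse steps ++ columns X        ≡⟨ sym (ʳ++-defn steps) ⟩
  steps ʳ++ columns X               ∎
  where
    open ≡-Reasoning
    steps : List (Letter × ℕ)
    steps = westSteps (southCount X) Y

southCount-∷ʳ : ∀ X x → southCount (X ∷ʳ x) ≡ southCount [ x ] + southCount X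
southCount-∷ʳ []      x = sym (+-identityʳ _)
southCount-∷ʳ (D ∷ X) x = trans (cong suc (southCount-∷ʳ X x)) (sym (+-suc _ _))
southCount-∷ʳ (E ∷ X) x = southCount-∷ʳ X x
southCount-∷ʳ (A ∷ X) x = trans (cong suc (southCount-∷ʳ X x)) (sym (+-suc _ _))

length-westSteps : ∀ k X → length (westSteps k X) ≡ westCount X
length-westSteps k []      = refl
length-westSteps k (D ∷ X) = length-westSteps (suc k) X
length-westSteps k (E ∷ X) = cong suc (length-westSteps k X)
length-westSteps k (A ∷ X) = cong suc (length-westSteps (suc k) X)

westSteps-≥ : ∀ {m} k X → m ≤ k → All (λ c → m ≤ proj₂ c) (westSteps k X)
westSteps-≥ k []      m≤k = []
westSteps-≥ k (D ∷ X) m≤k = westSteps-≥ (suc k) X (≤-trans m≤k (n≤1+n k))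
westSteps-≥ k (E ∷ X) m≤k = m≤k ∷ westSteps-≥ k X m≤k
westSteps-≥ k (A ∷ X) m≤k = m≤k ∷ westSteps-≥ (suc k) X (≤-trans m≤k (n≤1+n k))

-- West to east: the columns of the trailing E's of X, of full height southCount X, then shorter ones.
FullThenShort : Word → Set
FullThenShort X = ∃₂ λ n short →
  columns X ≡ replicate n (E , southCount X) ++ short × All (λ c → proj₂ c < southCount X) short

fullThenShort⇒columns-< : ∀ X → FullThenShort X → All (λ c → proj₂ c < suc (southCount X)) (columns X)
fullThenShort⇒columns-< X (n , short , full , short<) =
  subst (All _) (sym full) (++⁺ (replicate⁺ n ≤-refl) (All.map m<n⇒m<1+n short<))

fullThenShort-∷ʳ : ∀ X x → FullThenShort X → FullThenShort (X ∷ʳ x)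
fullThenShort-∷ʳ X D fts rewrite columns-++ X [ D ] | southCount-∷ʳ X D =
  0 , columns X , refl , fullThenShort⇒columns-< X fts
fullThenShort-∷ʳ X E (n , short , full , short<) rewrite columns-++ X [ E ] | southCount-∷ʳ X E =
  suc n , short , cong (_ ∷_) full , short<
fullThenShort-∷ʳ X A fts rewrite columns-++ X [ A ] | southCount-∷ʳ X A =
  0 , _ ∷ columns X , refl , ≤-refl ∷ fullThenShort⇒columns-< X fts

columns-fullThenShort : ∀ X → FullThenShort X
columns-fullThenShort X = go (reverseView X)
  where
    go : ∀ {X} → Reverse X → FullThenShort X
    go []              = 0 , [] , refl , []
    go (X ∶ view ∶ʳ x) = fullThenShort-∷ʳ X x (go view)

replicate-∷-++ : ∀ {S : Set} n (x : S) ys → x ∷ replicate n x ++ ys ≡ replicate n x ++ x ∷ ys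
replicate-∷-++ zero    x ys = refl
replicate-∷-++ (suc n) x ys = cong (x ∷_) (replicate-∷-++ n x ys)

rowTypes-swapE : ∀ X' a X'' → rowTypes (X' ++ E ∷ a ∷ X'') ≡ rowTypes (X' ++ a ∷ E ∷ X'')
rowTypes-swapE []       D X'' = refl
rowTypes-swapE []       E X'' = refl
rowTypes-swapE []       A X'' = refl
rowTypes-swapE (D ∷ X') a X'' = cong (D ∷_) (rowTypes-swapE X' a X'')
rowTypes-swapE (E ∷ X') a X'' = rowTypes-swapE X' a X''
rowTypes-swapE (A ∷ X') a X'' = cong (A ∷_) (rowTypes-swapE X' a X'')

nth-rowTypes-southCount : ∀ X' Y → nth (rowTypes (X' ++ D ∷ Y)) (southCount X') ≡ just D
nth-rowTypes-southCount []       Y = refl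
nth-rowTypes-southCount (D ∷ X') Y = nth-rowTypes-southCount X' Y
nth-rowTypes-southCount (E ∷ X') Y = nth-rowTypes-southCount X' Y
nth-rowTypes-southCount (A ∷ X') Y = nth-rowTypes-southCount X' Y

Required-rowType-E-α : ∀ X {i r} → nth (rowTypes X) i ≡ just r → Required r E α
Required-rowType-E-α (D ∷ X) {zero}  refl = inj₁ refl
Required-rowType-E-α (D ∷ X) {suc i} eq   = Required-rowType-E-α X eq
Required-rowType-E-α (E ∷ X)         eq   = Required-rowType-E-α X eq
Required-rowType-E-α (A ∷ X) {zero}  refl = refl
Required-rowType-E-α (A ∷ X) {suc i} eq   = Required-rowType-E-α X eq

nth-++-∷ : ∀ {S : Set} (xs : List S) x ys → nth (xs ++ x ∷ ys) (length xs) ≡ just x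
nth-++-∷ []       x ys = refl
nth-++-∷ (_ ∷ xs) x ys = nth-++-∷ xs x ys

nth-≥-length : ∀ {S : Set} (xs : List S) {i} → length xs ≤ i → nth xs i ≡ nothing
nth-≥-length []       _        = refl
nth-≥-length (_ ∷ xs) (s≤s le) = nth-≥-length xs le

removeAt-++-∷ : ∀ {S : Set} (xs : List S) x ys → removeAt (length xs) (xs ++ x ∷ ys) ≡ xs ++ ys
removeAt-++-∷ []       x ys = refl
removeAt-++-∷ (z ∷ xs) x ys = cong (z ∷_) (removeAt-++-∷ xs x ys)

entry-++-∷ : ∀ (P : Filling) col U i → entry (P ++ col ∷ U) (length P) i ≡ nth col i
entry-++-∷ P col U i = cong (maybe (λ c → nth c i) nothing) (nth-++-∷ P col U)

length-newCol : ∀ m → length (newCol m) ≡ m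
length-newCol zero          = refl
length-newCol (suc zero)    = refl
length-newCol (suc (suc m)) = cong suc (length-newCol (suc m))

nth-newCol : ∀ m {i c} → nth (newCol (suc m)) i ≡ just c → (i < m × c ≡ ∅) ⊎ (i ≡ m × c ≡ α)
nth-newCol zero    {zero}  refl = inj₂ (refl , refl)
nth-newCol (suc m) {zero}  refl = inj₁ (s≤s z≤n , refl)
nth-newCol (suc m) {suc i} eq   = Sum.map (Product.map₁ s≤s) (Product.map₁ (cong suc)) (nth-newCol m eq)

nth-newCol-bottom : ∀ m → nth (newCol (suc m)) m ≡ just α
nth-newCol-bottom zero    = refl
nth-newCol-bottom (suc m) = nth-newCol-bottom m

transitionα-++-∷ : ∀ (P : Filling) {col U p} → length col ≡ suc p →
  transitionα (P ++ col ∷ U) (length P) ≡ insertCol p (newCol p) (P ++ U)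
transitionα-++-∷ P {col} {U} len rewrite nth-++-∷ P col U | len | removeAt-++-∷ P col U = refl

insertCol-++ : ∀ {m c} P {U} → All (λ d → m ≤ length d) P → insertCol m c (P ++ U) ≡ P ++ insertCol m c U
insertCol-++ []      []                        = refl
insertCol-++ {m} (d ∷ P) (m≤d ∷ P≥) with m ≤ᵇ length d | ≤⇒≤ᵇ m≤d
... | true | _ = cong (d ∷_) (insertCol-++ P P≥)

insertCol-short : ∀ {m c U} → All (λ d → length d < m) U → insertCol m c U ≡ c ∷ U
insertCol-short []                       = refl
insertCol-short {m} {U = d ∷ _} (d<m ∷ _) with m ≤ᵇ length d | ≤ᵇ⇒≤ m (length d)
... | true  | m≤d = ⊥-elim (<⇒≱ d<m (m≤d _))
... | false | _   = refl

All-ʳ++⁺ : ∀ {S : Set} {Q : S → Set} {xs ys} → All Q xs → All Q ys → All Q (xs ʳ++ ys)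
All-ʳ++⁺ []         Qys = Qys
All-ʳ++⁺ (Qx ∷ Qxs) Qys = All-ʳ++⁺ Qxs (Qx ∷ Qys)

shape⇒length : ∀ {P : Filling} {cs : List (Letter × ℕ)} → map length P ≡ map proj₂ cs → length P ≡ length cs
shape⇒length {P} {cs} shape =
  trans (sym (length-map length P)) (trans (cong length shape) (length-map proj₂ cs))

shape⇒All : ∀ {Q : ℕ → Set} {P : Filling} {cs : List (Letter × ℕ)} →
  map length P ≡ map proj₂ cs → All (Q ∘ proj₂) cs → All (Q ∘ length) P
shape⇒All shape Qcs = map⁻ (subst (All _) (sym shape) (map⁺ Qcs))

BetaInRow : ℕ → Filling → Set
BetaInRow i U = Any (λ col → nth col i ≡ just β) U

AlphaBelow : List Cell → ℕ → Set
AlphaBelow col i = ∃[ i' ] i < i' × nth col i' ≡ just α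

BlockedIn : List Cell → Filling → ℕ → Set
BlockedIn col east i = BetaInRow i east ⊎ AlphaBelow col i

record ColumnOK (rows : List Letter) (k : Letter) (col : List Cell) (east : Filling) : Set where
  field
    blocked : ∀ {i c} → nth col i ≡ just c → BlockedIn col east i → c ≡ ∅
    free    : ∀ {i c r} → nth col i ≡ just c → ¬ BlockedIn col east i → nth rows i ≡ just r → Required r k c

data Valid (rows : List Letter) : List (Letter × ℕ) → Filling → Set where
  []     : Valid rows [] []
  column : ∀ {k n col cs U} → length col ≡ n → ColumnOK rows k col U → Valid rows cs U →
           Valid rows ((k , n) ∷ cs) (col ∷ U)

BetaInRow⇔entry : ∀ {i} U → BetaInRow i U ⇔ (∃[ j ] entry U j i ≡ just β)
BetaInRow⇔entry U = mk⇔ (located U) (unlocated U)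
  where
    located : ∀ {i} U → BetaInRow i U → ∃[ j ] entry U j i ≡ just β
    located (_ ∷ U) (here eq) = zero , eq
    located (_ ∷ U) (there b) = let (j , eq) = located U b in suc j , eq
    unlocated : ∀ {i} U → ∃[ j ] entry U j i ≡ just β → BetaInRow i U
    unlocated (_ ∷ U) (zero  , eq) = here eq
    unlocated (_ ∷ U) (suc j , eq) = there (unlocated U (j , eq))

Blocked-∷-zero : ∀ {col U i} → Blocked (col ∷ U) i zero ⇔ BlockedIn col U i
Blocked-∷-zero {col} {U} = mk⇔ to′ from′
  where
    to′ : ∀ {i} → Blocked (col ∷ U) i zero → BlockedIn col U i
    to′ (inj₁ (suc j , _ , eq)) = inj₁ (from (BetaInRow⇔entry U) (j , eq))
    to′ (inj₂ below)            = inj₂ below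
    from′ : ∀ {i} → BlockedIn col U i → Blocked (col ∷ U) i zero
    from′ (inj₁ b)     = let (j , eq) = to (BetaInRow⇔entry U) b in inj₁ (suc j , s≤s z≤n , eq)
    from′ (inj₂ below) = inj₂ below

Blocked-∷-suc : ∀ {col U i j} → Blocked (col ∷ U) i (suc j) ⇔ Blocked U i j
Blocked-∷-suc {col} {U} = mk⇔ to′ from′
  where
    to′ : ∀ {i j} → Blocked (col ∷ U) i (suc j) → Blocked U i j
    to′ (inj₁ (suc j' , s≤s lt , eq)) = inj₁ (j' , lt , eq)
    to′ (inj₂ below)                  = inj₂ below
    from′ : ∀ {i j} → Blocked U i j → Blocked (col ∷ U) i (suc j)
    from′ (inj₁ (j' , lt , eq)) = inj₁ (suc j' , s≤s lt , eq)
    from′ (inj₂ below)          = inj₂ below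

BlockedEmpty : Filling → Set
BlockedEmpty T = ∀ i j c → entry T j i ≡ just c → Blocked T i j → c ≡ ∅

FreeRequired : List Letter → List Letter → Filling → Set
FreeRequired rows ks T = ∀ i j c → entry T j i ≡ just c → ¬ Blocked T i j →
  ∀ r k → nth rows i ≡ just r → nth ks j ≡ just k → Required r k c

toValid : ∀ {rows} cs {T} → map length T ≡ map proj₂ cs →
  BlockedEmpty T → FreeRequired rows (map proj₁ cs) T → Valid rows cs T
toValid []             {[]}    _     _     _    = []
toValid ((k , n) ∷ cs) {col ∷ U} shape empty free =
  column (∷-injectiveˡ shape) ok
    (toValid cs (∷-injectiveʳ shape)
      (λ i j c eq b → empty i (suc j) c eq (from Blocked-∷-suc b))
      (λ i j c eq nb → free i (suc j) c eq (nb ∘ to Blocked-∷-suc)))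
  where
    ok : ColumnOK _ k col U
    ok = record
      { blocked = λ eq b → empty _ zero _ eq (from Blocked-∷-zero b)
      ; free    = λ eq nb er → free _ zero _ eq (nb ∘ to Blocked-∷-zero) _ k er refl }

Valid-shape : ∀ {rows cs T} → Valid rows cs T → map length T ≡ map proj₂ cs
Valid-shape []                  = refl
Valid-shape (column len _ rest) = cong₂ _∷_ len (Valid-shape rest)

fromValid : ∀ {rows cs T} → Valid rows cs T → BlockedEmpty T × FreeRequired rows (map proj₁ cs) T
fromValid [] = (λ _ _ _ ()) , (λ _ _ _ ())
fromValid {rows} {(k , _) ∷ cs} {col ∷ U} (column _ ok rest) = empty , free
  where
    empty : BlockedEmpty (col ∷ U)
    empty i zero    c eq b = ColumnOK.blocked ok eq (to Blocked-∷-zero b)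
    empty i (suc j) c eq b = proj₁ (fromValid rest) i j c eq (to Blocked-∷-suc b)
    free : FreeRequired rows (k ∷ map proj₁ cs) (col ∷ U)
    free i zero    c eq nb r .k er refl = ColumnOK.free ok eq (nb ∘ from Blocked-∷-zero) er
    free i (suc j) c eq nb              = proj₂ (fromValid rest) i j c eq (nb ∘ from Blocked-∷-suc)

isCMCT⇒Valid : ∀ {X T} → IsCMCT X T → Valid (rowTypes X) (columns X) T
isCMCT⇒Valid {X} cT = toValid (columns X) shape blocked free
  where open IsCMCT cT

Valid⇒isCMCT : ∀ {X T} → Valid (rowTypes X) (columns X) T → IsCMCT X T
Valid⇒isCMCT v = record { shape = Valid-shape v ; blocked = proj₁ (fromValid v) ; free = proj₂ (fromValid v) }

SameBetaRows : Filling → Filling → Set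
SameBetaRows U U' = ∀ i → BetaInRow i U ⇔ BetaInRow i U'

βFree : List Cell → Set
βFree col = ∀ {i} → nth col i ≢ just β

βFree⇒SameBetaRows-∷ : ∀ {col U} → βFree col → SameBetaRows (col ∷ U) U
βFree⇒SameBetaRows-∷ noβ i = mk⇔ (λ { (here eq) → ⊥-elim (noβ eq) ; (there b) → b }) there

SameBetaRows-++ˡ : ∀ P {U U'} → SameBetaRows U U' → SameBetaRows (P ++ U) (P ++ U')
SameBetaRows-++ˡ P same i = mk⇔ (extend (to (same i))) (extend (from (same i)))
  where
    extend : ∀ {V V'} → (BetaInRow i V → BetaInRow i V') → BetaInRow i (P ++ V) → BetaInRow i (P ++ V')
    extend f = [ ++⁺ˡ , ++⁺ʳ P ∘ f ]′ ∘ ++⁻ P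

ColumnOK-resp : ∀ {rows k col U U'} → SameBetaRows U U' → ColumnOK rows k col U → ColumnOK rows k col U'
ColumnOK-resp same ok = record
  { blocked = λ eq → ColumnOK.blocked ok eq ∘ Sum.map₁ (from (same _))
  ; free    = λ eq nb → ColumnOK.free ok eq (nb ∘ Sum.map₁ (to (same _))) }

Valid-split : ∀ {rows} cs {ds T} → Valid rows (cs ++ ds) T →
  ∃₂ λ P U → T ≡ P ++ U × map length P ≡ map proj₂ cs × Valid rows ds U
Valid-split []       v = [] , _ , refl , refl , v
Valid-split (_ ∷ cs) (column {col = col} len _ rest) with Valid-split cs rest
... | P , U , refl , shape , v = col ∷ P , U , refl , cong₂ _∷_ len shape , v

Valid-replace : ∀ {rows} cs {ds ds' P U U'} → length P ≡ length cs → SameBetaRows U U' →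
  Valid rows ds' U' → Valid rows (cs ++ ds) (P ++ U) → Valid rows (cs ++ ds') (P ++ U')
Valid-replace []       {P = []}    _   _    v' _ = v'
Valid-replace (_ ∷ cs) {P = _ ∷ P} len same v' (column l ok rest) =
  column l (ColumnOK-resp (SameBetaRows-++ˡ P same) ok) (Valid-replace cs (suc-injective len) same v' rest)

α-unblocked : ∀ {rows k col U i} → ColumnOK rows k col U → nth col i ≡ just α → ¬ BlockedIn col U i
α-unblocked ok eq b with () ← ColumnOK.blocked ok eq b

ColumnOK-α-bottom⇒βFree : ∀ {rows k col U p} → ColumnOK rows k col U →
  length col ≡ suc p → nth col p ≡ just α → βFree col
ColumnOK-α-bottom⇒βFree {col = col} {p = p} ok len αp {i} eq with <-cmp i p
... | tri< i<p _ _ with () ← ColumnOK.blocked ok eq (inj₂ (p , i<p , αp))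
... | tri≈ _ refl _ with () ← trans (sym eq) αp
... | tri> _ _ p<i with () ← trans (sym (nth-≥-length col (subst (_≤ i) (sym len) p<i))) eq

newCol-βFree : ∀ m → βFree (newCol m)
newCol-βFree (suc m) eq with nth-newCol m eq
... | inj₁ (_ , ())
... | inj₂ (_ , ())

newCol-ColumnOK : ∀ {rows U} m → (∀ {i r} → nth rows i ≡ just r → Required r E α) →
  All (λ d → length d < m) U → ColumnOK rows E (newCol m) U
newCol-ColumnOK zero    _      _  = record { blocked = λ () ; free = λ () }
newCol-ColumnOK {rows} {U} (suc m) admitsα U< = record { blocked = blocked ; free = free }
  where
    noβ-bottom : ¬ BetaInRow m U
    noβ-bottom = All¬⇒¬Any (All.map (λ {d} → short-noβ {d}) U<)
      where
        short-noβ : ∀ {d} → length d < suc m → nth d m ≢ just β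
        short-noβ {d} (s≤s d≤m) eq with () ← trans (sym (nth-≥-length d d≤m)) eq
    bottom-free : ¬ BlockedIn (newCol (suc m)) U m
    bottom-free (inj₁ b)               = noβ-bottom b
    bottom-free (inj₂ (i' , m<i' , eq)) with nth-newCol m eq
    ... | inj₁ (i'<m , _) = <-asym m<i' i'<m
    ... | inj₂ (refl , _) = <-irrefl refl m<i'
    blocked : ∀ {i c} → nth (newCol (suc m)) i ≡ just c → BlockedIn (newCol (suc m)) U i → c ≡ ∅
    blocked eq b with nth-newCol m eq
    ... | inj₁ (_ , c≡∅)    = c≡∅
    ... | inj₂ (refl , _)   = ⊥-elim (bottom-free b)
    free : ∀ {i c r} → nth (newCol (suc m)) i ≡ just c → ¬ BlockedIn (newCol (suc m)) U i →
           nth rows i ≡ just r → Required r E c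
    free eq nb er with nth-newCol m eq
    ... | inj₁ (i<m , _)     = ⊥-elim (nb (inj₂ (m , i<m , nth-newCol-bottom m)))
    ... | inj₂ (refl , refl) = admitsα er

ColumnOK-DA-α : ∀ {rows col U i} → ColumnOK rows A col U → nth rows i ≡ just D → nth col i ≢ just α
ColumnOK-DA-α ok rowD eq with () ← ColumnOK.free ok eq (α-unblocked ok eq) rowD

transition-Valid : ∀ {rows p q} west middle east {T} → length west ≡ q →
  (∀ {i r} → nth rows i ≡ just r → Required r E α) →
  All (λ c → p ≤ proj₂ c) west → All (λ c → p ≤ proj₂ c) middle → All (λ c → proj₂ c < p) east →
  Valid rows (west ++ (E , suc p) ∷ middle ++ east) T → entry T q p ≡ just α →
  Valid rows (west ++ middle ++ (E , p) ∷ east) (transitionα T q)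
transition-Valid {rows} {p} west middle east refl admitsα west≥ middle≥ east< v αp
  with Valid-split west v
... | W , _ , refl , W-shape , column {col = col} col-len col-ok rest
  with Valid-split middle rest
... | M , Es , refl , M-shape , east-valid
  rewrite sym (shape⇒length W-shape) =
  subst (Valid rows _) (sym moved) (Valid-replace west (shape⇒length W-shape) swapped middle-valid v)
  where
    new : List Cell
    new = newCol p
    colβFree : βFree col
    colβFree = ColumnOK-α-bottom⇒βFree col-ok col-len (trans (sym (entry-++-∷ W col _ p)) αp)
    Es< : All (λ d → length d < p) Es
    Es< = shape⇒All (Valid-shape east-valid) east<
    new-east : SameBetaRows Es (new ∷ Es)
    new-east i = ⇔.sym (βFree⇒SameBetaRows-∷ (newCol-βFree p) i)
    swapped : SameBetaRows (col ∷ M ++ Es) (M ++ new ∷ Es)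
    swapped i = ⇔.trans (βFree⇒SameBetaRows-∷ colβFree i) (SameBetaRows-++ˡ M new-east i)
    middle-valid : Valid rows (middle ++ (E , p) ∷ east) (M ++ new ∷ Es)
    middle-valid = Valid-replace middle (shape⇒length M-shape) new-east
      (column (length-newCol p) (newCol-ColumnOK p admitsα Es<) east-valid) rest
    moved : transitionα (W ++ col ∷ M ++ Es) (length W) ≡ W ++ M ++ new ∷ Es
    moved = begin
      transitionα (W ++ col ∷ M ++ Es) (length W) ≡⟨ transitionα-++-∷ W col-len ⟩
      insertCol p new (W ++ M ++ Es)               ≡⟨ insertCol-++ W (shape⇒All W-shape west≥) ⟩
      W ++ insertCol p new (M ++ Es)               ≡⟨ cong (W ++_) (insertCol-++ M (shape⇒All M-shape middle≥)) ⟩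
      W ++ M ++ insertCol p new Es                 ≡⟨ cong (λ U → W ++ M ++ U) (insertCol-short Es<) ⟩
      W ++ M ++ new ∷ Es                           ∎
      where open ≡-Reasoning

module Corner (X' X'' : Word) where

  p : ℕ
  p = southCount X'

  W west : List (Letter × ℕ)
  W    = westSteps (suc p) X''
  west = reverse W

  length-reverse-westSteps : ∀ k → length (reverse (westSteps k X'')) ≡ westCount X''
  length-reverse-westSteps k = trans (length-reverse (westSteps k X'')) (length-westSteps k X'')

  transition-isCMCT : ∀ {X X₂ T} pre → All (λ c → p ≤ proj₂ c) pre →
    columns X ≡ W ʳ++ (E , suc p) ∷ pre ++ columns X' →
    columns X₂ ≡ W ʳ++ pre ++ (E , p) ∷ columns X' →
    rowTypes X₂ ≡ rowTypes X →
    IsCMCT X T → entry T (westCount X'') p ≡ just α → IsCMCT X₂ (transitionα T (westCount X''))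
  transition-isCMCT {X} {X₂} {T} pre pre≥ cols cols₂ rows cT αp with columns-fullThenShort X'
  ... | n , east , full , east< =
    Valid⇒isCMCT (subst₂ (λ rs cs → Valid rs cs (transitionα T (westCount X''))) (sym rows) (sym cols₂')
      (transition-Valid west middle east (length-reverse-westSteps (suc p)) (Required-rowType-E-α X)
        west≥ middle≥ east< (subst (λ cs → Valid (rowTypes X) cs T) cols' (isCMCT⇒Valid cT)) αp))
    where
      open ≡-Reasoning
      run middle : List (Letter × ℕ)
      run    = replicate n (E , p)
      middle = pre ++ run
      west≥ : All (λ c → p ≤ proj₂ c) west
      west≥ = All-ʳ++⁺ (westSteps-≥ (suc p) X'' (n≤1+n p)) []
      middle≥ : All (λ c → p ≤ proj₂ c) middle
      middle≥ = ++⁺ pre≥ (replicate⁺ n ≤-refl)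
      cols' : columns X ≡ west ++ (E , suc p) ∷ middle ++ east
      cols' = begin
        columns X                                 ≡⟨ cols ⟩
        W ʳ++ (E , suc p) ∷ pre ++ columns X'     ≡⟨ ʳ++-defn W ⟩
        west ++ (E , suc p) ∷ pre ++ columns X'   ≡⟨ cong (λ cs → west ++ (E , suc p) ∷ pre ++ cs) full ⟩
        west ++ (E , suc p) ∷ pre ++ run ++ east  ≡⟨ cong (λ cs → west ++ (E , suc p) ∷ cs) (sym (++-assoc pre run east)) ⟩
        west ++ (E , suc p) ∷ middle ++ east      ∎
      cols₂' : columns X₂ ≡ west ++ middle ++ (E , p) ∷ east
      cols₂' = begin
        columns X₂                            ≡⟨ cols₂ ⟩
        W ʳ++ pre ++ (E , p) ∷ columns X'     ≡⟨ ʳ++-defn W ⟩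
        west ++ pre ++ (E , p) ∷ columns X'   ≡⟨ cong (λ cs → west ++ pre ++ (E , p) ∷ cs) full ⟩
        west ++ pre ++ (E , p) ∷ run ++ east  ≡⟨ cong (λ cs → west ++ pre ++ cs) (replicate-∷-++ n (E , p) east) ⟩
        west ++ pre ++ run ++ (E , p) ∷ east  ≡⟨ cong (west ++_) (sym (++-assoc pre run _)) ⟩
        west ++ middle ++ (E , p) ∷ east      ∎

  columns-DA : columns (X' ++ D ∷ A ∷ X'') ≡ reverse (westSteps (suc (suc p)) X'') ++ (A , suc p) ∷ columns X'
  columns-DA = trans (columns-++ X' (D ∷ A ∷ X'')) (ʳ++-defn (westSteps (suc (suc p)) X''))

  corner-DA-not-α : ∀ {T} → IsCMCT (X' ++ D ∷ A ∷ X'') T → entry T (westCount X'') p ≢ just α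
  corner-DA-not-α {T} cT αp
    with Valid-split (reverse (westSteps (suc (suc p)) X''))
           (subst (λ cs → Valid (rowTypes (X' ++ D ∷ A ∷ X'')) cs T) columns-DA (isCMCT⇒Valid cT))
  ... | P , col ∷ U , refl , shape , column _ ok _ =
    ColumnOK-DA-α ok (nth-rowTypes-southCount X' (A ∷ X'')) corner-α
    where
      P-length : length P ≡ westCount X''
      P-length = trans (shape⇒length shape) (length-reverse-westSteps (suc (suc p)))
      corner-α : nth col p ≡ just α
      corner-α = trans (sym (entry-++-∷ P col U p))
                       (subst (λ j → entry (P ++ col ∷ U) j p ≡ just α) (sym P-length) αp)

lemma4p4 : (X' X'' : Word) (a b : Letter) → CornerPair a b →
           (T : Filling) → IsCMCT (X' ++ a ∷ b ∷ X'') T →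
           entry T (westCount X'') (southCount X') ≡ just α →
           IsCMCT (X' ++ b ∷ a ∷ X'') (transitionα T (westCount X''))
lemma4p4 X' X'' .D .E DE T cT αp =
  transition-isCMCT [] [] (columns-++ X' _) (columns-++ X' _) (rowTypes-swapE X' D X'') cT αp
  where open Corner X' X''
lemma4p4 X' X'' .A .E AE T cT αp =
  transition-isCMCT [ (A , p) ] (≤-refl ∷ []) (columns-++ X' _) (columns-++ X' _) (rowTypes-swapE X' A X'') cT αp
  where open Corner X' X''
lemma4p4 X' X'' .D .A DA T cT αp = ⊥-elim (corner-DA-not-α cT αp)
  where open Corner X' X''
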